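{- For every $n\ge1$, the number of upper triangular matrices $P\in\{0,1\}^{n\times n}$ such that $\mathrm{conv}\{0,\text{columns of }P\}$ is an orthogonal $0/1$-simplex in $[0,1]^n$ equals $n!$.
   Context: A $0/1$-simplex in $[0,1]^n$ is the convex hull of $n+1$ affinely independent points of $\{0,1\}^n$; it is nonobtuse if each dihedral angle ($\pi$ minus the angle between inward facet normals) is at most $\pi/2$. Orthogonal $0/1$-simplices are defined recursively: the segment $[0,1]=I^1$ is orthogonal; for $n\ge2$, a nonobtuse $0/1$-simplex $S\subset[0,1]^n$ is orthogonal if it has an $(n-1)$-dimensional facet $F$ contained in some $(n-1)$-dimensional facet $C$ of $[0,1]^n$ such that $F$, regarded as a $0/1$-simplex in $C\cong[0,1]^{n-1}$ (deleting the coordinate that is constant on $C$), is orthogonal. -}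

module Defs where

open import Data.Nat using (ℕ; zero; suc)
open import Data.Bool using (Bool; true; false)
open import Data.Fin using (Fin; punchIn) renaming (zero to fzero; suc to fsuc; _<_ to _<ᶠ_)
open import Data.Vec using (Vec; lookup)
open import Data.Rational using (ℚ; 0ℚ; 1ℚ; _+_; _-_; _*_; _<_; _≤_)
open import Data.Product using (_×_)
open import Relation.Binary.PropositionalEquality using (_≡_; _≢_)
open import Function using (_∘_)

Point : ℕ → Set
Point n = Fin n → Bool

toℚ : Bool → ℚ
toℚ false = 0ℚ
toℚ true  = 1ℚ

sumF : ∀ {n} → (Fin n → ℚ) → ℚ
sumF {zero}  f = 0ℚ
sumF {suc n} f = f fzero + sumF (f ∘ fsuc)

dot : ∀ {n} → (Fin n → ℚ) → (Fin n → ℚ) → ℚ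
dot u w = sumF (λ k → u k * w k)

diff : ∀ {m n} → (Fin m → Point n) → Fin m → Fin m → (Fin n → ℚ)
diff v i j k = toℚ (v i k) - toℚ (v j k)

-- v_0, ..., v_n are affinely independent: v_1 - v_0, ..., v_n - v_0 are
-- linearly independent over ℚ (equivalently over ℝ, since the data is rational)
AffIndep : ∀ {n} → (Fin (suc n) → Point n) → Set
AffIndep {n} v =
  (c : Fin n → ℚ) →
  (∀ k → sumF (λ j → c j * diff v (fsuc j) fzero k) ≡ 0ℚ) →
  ∀ j → c j ≡ 0ℚ

Simplex01 : ∀ {n} → (Fin (suc n) → Point n) → Set
Simplex01 = AffIndep

InwardNormal : ∀ {n} → (Fin (suc n) → Point n) → Fin (suc n) → (Fin n → ℚ) → Set
InwardNormal v i u =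
  (∀ j k → j ≢ i → k ≢ i → dot u (diff v j k) ≡ 0ℚ) ×
  (∀ j → j ≢ i → 0ℚ < dot u (diff v i j))

-- every dihedral angle is ≤ π/2, i.e. the angle between any two inward
-- facet normals is ≥ π/2, i.e. their inner product is ≤ 0
Nonobtuse : ∀ {n} → (Fin (suc n) → Point n) → Set
Nonobtuse v =
  ∀ i j → i ≢ j → ∀ u w → InwardNormal v i u → InwardNormal v j w → dot u w ≤ 0ℚ

-- Base: in dimension 1 the only 0/1-simplex is the segment [0,1] = I^1.
-- Step (n = m+2 ≥ 2): S nonobtuse, and the facet opposite vertex i lies in the
-- cube facet {x_k = b}; deleting coordinate k, it is orthogonal in [0,1]^(n-1).
data Orthogonal : (n : ℕ) → (Fin (suc n) → Point n) → Set where
  segment : (v : Fin 2 → Point 1) → Simplex01 v → Orthogonal 1 v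
  step : ∀ {m} (v : Fin (suc (suc (suc m))) → Point (suc (suc m))) →
         Simplex01 v → Nonobtuse v →
         (i : Fin (suc (suc (suc m)))) (k : Fin (suc (suc m))) (b : Bool) →
         (∀ j → v (punchIn i j) k ≡ b) →
         Orthogonal (suc m) (λ j → v (punchIn i j) ∘ punchIn k) →
         Orthogonal (suc (suc m)) v

Matrix : ℕ → Set
Matrix n = Vec (Vec Bool n) n

entry : ∀ {n} → Matrix n → Fin n → Fin n → Bool
entry P i j = lookup (lookup P i) j

UpperTriangular : ∀ {n} → Matrix n → Set
UpperTriangular P = ∀ i j → j <ᶠ i → entry P i j ≡ false

vertsOf : ∀ {n} → Matrix n → Fin (suc n) → Point n
vertsOf P fzero    = λ _ → false
vertsOf P (fsuc j) = λ i → entry P i j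

module Submission where

-- Let v 0 = 0 and v j be the j-th column of P. For upper triangular P the simplex of P is the
-- pyramid over the simplex of its leading block, placed in the hyperplane x_n = 0, with apex
-- (c, P_nn), where c is the rest of the last column. Affine independence forces P_nn = 1.
-- Nonobtuseness passes to the base; moreover, lifting the inward normal of the base facet opposite
-- vertex i to an inward normal of the pyramid gives it last coordinate -λ_i(c), where λ_i(c) is
-- the i-th barycentric coordinate of c, and pairing it with the inward normal e_n of the base
-- shows λ_i(c) ≥ 0. A 0/1 point in a 0/1 simplex is a vertex, so c is one of the n vertices of
-- the base. Conversely every simplex built by such steps is nonobtuse, and orthogonal because its
-- facet opposite the apex lies in x_n = 0. So these matrices arise column by column with n
-- choices for the n-th column: n! in all.

module OrthogonalSimplices where

  open import Defs
  open import Data.Bool using (Bool; true; false)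
  open import Data.Empty using (⊥-elim)
  open import Data.Fin using (Fin; inject₁; fromℕ; punchIn; toℕ)
    renaming (zero to fzero; suc to fsuc; _<_ to _<ᶠ_)
  open import Data.Fin.Properties
    using (fromℕ≢inject₁; inject₁-injective; _≟_; toℕ-inject₁; toℕ-fromℕ; inject₁ℕ<)
  open import Data.Fin.Relation.Unary.Top using (view; ‵fromℕ; ‵inject₁)
  open import Data.List using (List; []; _∷_; [_]; length; map; concatMap; allFin)
  open import Data.List.Properties using (length-++; length-map; length-tabulate)
  open import Data.List.Membership.Propositional using (_∈_; find; lose)
  open import Data.List.Membership.Propositional.Properties
    using (∈-concatMap⁺; ∈-concatMap⁻; ∈-map⁺; ∈-map⁻; ∈-allFin)
  open import Data.List.Relation.Unary.Any using (here; there)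
  import Data.List.Relation.Unary.All as All
  import Data.List.Relation.Unary.AllPairs as AllPairs
  open import Data.List.Relation.Unary.Unique.Propositional using (Unique)
  open import Data.List.Relation.Unary.Unique.Propositional.Properties using (map⁺; ++⁺; allFin⁺)
  open import Data.Nat using (ℕ; zero; suc; z≤n; s≤s; _!)
  import Data.Nat as ℕ
  import Data.Nat.Properties as ℕ
  open import Data.Product using (_×_; _,_; proj₁; proj₂; ∃)
  open import Data.Rational using (ℚ; 0ℚ; 1ℚ; _+_; _-_; _*_; -_; _<_; _≤_; nonNegative; nonPositive)
  open import Data.Rational.Properties hiding (_≟_)
  open import Data.Rational.Solver using (module +-*-Solver)
  open import Algebra.Properties.Group +-0-group
    using (x∙y⁻¹≈ε⇒x≈y; x≈y⇒x∙y⁻¹≈ε; ⁻¹-involutive)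
  open import Data.Vec using ([]; tabulate; lookup)
  open import Data.Vec.Functional using (init; last)
  open import Data.Vec.Properties using (lookup∘tabulate; tabulate∘lookup; tabulate-cong)
  open import Function using (_∘_; id)
  open import Relation.Binary.PropositionalEquality
    using (_≡_; _≢_; _≗_; refl; sym; trans; cong; cong₂; subst; subst₂; module ≡-Reasoning)
  open import Relation.Nullary using (¬_; yes; no)
  open +-*-Solver

  init-last-elim : ∀ {n} {P : Fin (suc n) → Set} → (∀ j → P (inject₁ j)) → P (fromℕ n) → ∀ j → P j
  init-last-elim P-init P-last j with view j
  ... | ‵inject₁ j′ = P-init j′
  ... | ‵fromℕ      = P-last

  infixl 5 _∷ʳ_

  _∷ʳ_ : ∀ {n} {A : Set} → (Fin n → A) → A → Fin (suc n) → A
  _∷ʳ_ {zero}  f x _        = x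
  _∷ʳ_ {suc n} f x fzero    = f fzero
  _∷ʳ_ {suc n} f x (fsuc j) = ((f ∘ fsuc) ∷ʳ x) j

  init-∷ʳ : ∀ {n} {A : Set} (f : Fin n → A) x j → init (f ∷ʳ x) j ≡ f j
  init-∷ʳ {suc n} f x fzero    = refl
  init-∷ʳ {suc n} f x (fsuc j) = init-∷ʳ (f ∘ fsuc) x j

  last-∷ʳ : ∀ {n} {A : Set} (f : Fin n → A) x → last (f ∷ʳ x) ≡ x
  last-∷ʳ {zero}  f x = refl
  last-∷ʳ {suc n} f x = last-∷ʳ (f ∘ fsuc) x

  ∷ʳ-cong : ∀ {n} {A : Set} {f g : Fin n → A} {x y} → f ≗ g → x ≡ y → f ∷ʳ x ≗ g ∷ʳ y
  ∷ʳ-cong {zero}  f≗g x≡y j        = x≡y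
  ∷ʳ-cong {suc n} f≗g x≡y fzero    = f≗g fzero
  ∷ʳ-cong {suc n} f≗g x≡y (fsuc j) = ∷ʳ-cong (f≗g ∘ fsuc) x≡y j

  sumF-cong : ∀ {n} {f g : Fin n → ℚ} → f ≗ g → sumF f ≡ sumF g
  sumF-cong {zero}  f≗g = refl
  sumF-cong {suc n} f≗g = cong₂ _+_ (f≗g fzero) (sumF-cong (f≗g ∘ fsuc))

  sumF-zero : ∀ {n} {f : Fin n → ℚ} → (∀ k → f k ≡ 0ℚ) → sumF f ≡ 0ℚ
  sumF-zero {zero}  f≗0 = refl
  sumF-zero {suc n} f≗0 = trans (cong₂ _+_ (f≗0 fzero) (sumF-zero (f≗0 ∘ fsuc))) (+-identityʳ 0ℚ)

  sumF-init-last : ∀ {n} (f : Fin (suc n) → ℚ) → sumF f ≡ sumF (init f) + last f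
  sumF-init-last {zero}  f = trans (+-identityʳ (f fzero)) (sym (+-identityˡ (f fzero)))
  sumF-init-last {suc n} f = trans (cong (f fzero +_) (sumF-init-last (f ∘ fsuc))) (sym (+-assoc (f fzero) _ _))

  sumF-neg : ∀ {n} (f : Fin n → ℚ) → sumF (λ k → - f k) ≡ - sumF f
  sumF-neg {zero}  f = refl
  sumF-neg {suc n} f =
    trans (cong (- f fzero +_) (sumF-neg (f ∘ fsuc))) (sym (neg-distrib-+ (f fzero) (sumF (f ∘ fsuc))))

  sumF-sub : ∀ {n} (f g : Fin n → ℚ) → sumF (λ k → f k - g k) ≡ sumF f - sumF g
  sumF-sub {zero}  f g = refl
  sumF-sub {suc n} f g =
    trans (cong (f fzero - g fzero +_) (sumF-sub (f ∘ fsuc) (g ∘ fsuc)))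
          (solve 4 (λ a b A B → (a :- b) :+ (A :- B) := (a :+ A) :- (b :+ B)) refl
                 (f fzero) (g fzero) (sumF (f ∘ fsuc)) (sumF (g ∘ fsuc)))

  dot-congˡ : ∀ {n} {u u′ : Fin n → ℚ} (w : Fin n → ℚ) → u ≗ u′ → dot u w ≡ dot u′ w
  dot-congˡ w u≗u′ = sumF-cong (λ k → cong (_* w k) (u≗u′ k))

  dot-congʳ : ∀ {n} (u : Fin n → ℚ) {w w′ : Fin n → ℚ} → w ≗ w′ → dot u w ≡ dot u w′
  dot-congʳ u w≗w′ = sumF-cong (λ k → cong (u k *_) (w≗w′ k))

  dot-comm : ∀ {n} (u w : Fin n → ℚ) → dot u w ≡ dot w u
  dot-comm u w = sumF-cong (λ k → *-comm (u k) (w k))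

  dot-zeroˡ : ∀ {n} (w : Fin n → ℚ) → dot (λ _ → 0ℚ) w ≡ 0ℚ
  dot-zeroˡ w = sumF-zero (λ k → *-zeroˡ (w k))

  dot-zeroʳ : ∀ {n} (u : Fin n → ℚ) → dot u (λ _ → 0ℚ) ≡ 0ℚ
  dot-zeroʳ u = sumF-zero (λ k → *-zeroʳ (u k))

  dot-init-last : ∀ {n} (u w : Fin (suc n) → ℚ) → dot u w ≡ dot (init u) (init w) + last u * last w
  dot-init-last u w = sumF-init-last (λ k → u k * w k)

  dot-∷ʳˡ : ∀ {n} (u : Fin n → ℚ) α (w : Fin (suc n) → ℚ) → dot (u ∷ʳ α) w ≡ dot u (init w) + α * last w
  dot-∷ʳˡ u α w = trans (dot-init-last (u ∷ʳ α) w)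
    (cong₂ _+_ (dot-congˡ (init w) (init-∷ʳ u α)) (cong (_* last w) (last-∷ʳ u α)))

  dot-∷ʳ : ∀ {n} (u : Fin n → ℚ) α (w : Fin n → ℚ) β → dot (u ∷ʳ α) (w ∷ʳ β) ≡ dot u w + α * β
  dot-∷ʳ u α w β = trans (dot-init-last (u ∷ʳ α) (w ∷ʳ β))
    (cong₂ _+_ (sumF-cong (λ k → cong₂ _*_ (init-∷ʳ u α k) (init-∷ʳ w β k)))
               (cong₂ _*_ (last-∷ʳ u α) (last-∷ʳ w β)))

  lastUnit : ∀ {n} → Fin (suc n) → ℚ
  lastUnit = (λ _ → 0ℚ) ∷ʳ 1ℚ

  dot-∷ʳ-lastUnit : ∀ {n} (u : Fin n → ℚ) α → dot (u ∷ʳ α) lastUnit ≡ α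
  dot-∷ʳ-lastUnit u α = begin
    dot (u ∷ʳ α) lastUnit           ≡⟨ dot-∷ʳ u α (λ _ → 0ℚ) 1ℚ ⟩
    dot u (λ _ → 0ℚ) + α * 1ℚ       ≡⟨ cong₂ _+_ (dot-zeroʳ u) (*-identityʳ α) ⟩
    0ℚ + α                          ≡⟨ +-identityˡ α ⟩
    α                               ∎
    where open ≡-Reasoning

  p<q⇒0<q-p : ∀ {p q} → p < q → 0ℚ < q - p
  p<q⇒0<q-p {p} {q} p<q = subst (_< q - p) (+-inverseʳ p) (+-monoˡ-< (- p) p<q)

  0<q-p⇒p<q : ∀ {p q} → 0ℚ < q - p → p < q
  0<q-p⇒p<q {p} {q} 0<q-p =
    subst₂ _<_ (+-identityˡ p) (solve 2 (λ q p → (q :- p) :+ p := q) refl q p) (+-monoˡ-< p 0<q-p)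

  p≤q⇒p-q≤0 : ∀ {p q} → p ≤ q → p - q ≤ 0ℚ
  p≤q⇒p-q≤0 {p} {q} p≤q = subst (p - q ≤_) (+-inverseʳ q) (+-monoˡ-≤ (- q) p≤q)

  -p≤0⇒0≤p : ∀ {p} → - p ≤ 0ℚ → 0ℚ ≤ p
  -p≤0⇒0≤p {p} -p≤0 = subst (0ℚ ≤_) (⁻¹-involutive p) (neg-antimono-≤ -p≤0)

  x+y≤0⇒x≤0 : ∀ {x y} → 0ℚ ≤ y → x + y ≤ 0ℚ → x ≤ 0ℚ
  x+y≤0⇒x≤0 {x} 0≤y x+y≤0 =
    ≤-trans (≤-reflexive (sym (+-identityʳ x))) (≤-trans (+-monoʳ-≤ x 0≤y) x+y≤0)

  nonNeg*nonNeg≥0 : ∀ {a b} → 0ℚ ≤ a → 0ℚ ≤ b → 0ℚ ≤ a * b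
  nonNeg*nonNeg≥0 {a} {b} 0≤a 0≤b =
    nonNegative⁻¹ _ {{nonNeg*nonNeg⇒nonNeg a {{nonNegative 0≤a}} b {{nonNegative 0≤b}}}}

  nonNeg*nonPos≤0 : ∀ {a b} → 0ℚ ≤ a → b ≤ 0ℚ → a * b ≤ 0ℚ
  nonNeg*nonPos≤0 {a} {b} 0≤a b≤0 =
    nonPositive⁻¹ _ {{nonNeg*nonPos⇒nonPos a {{nonNegative 0≤a}} b {{nonPositive b≤0}}}}

  nonPos*nonPos≥0 : ∀ {a b} → a ≤ 0ℚ → b ≤ 0ℚ → 0ℚ ≤ a * b
  nonPos*nonPos≥0 {a} {b} a≤0 b≤0 =
    nonNegative⁻¹ _ {{nonPos*nonPos⇒nonPos a {{nonPositive a≤0}} b {{nonPositive b≤0}}}}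

  -- Heights and inward normals

  height : ∀ {m n} → (Fin n → ℚ) → (Fin m → Point n) → Fin m → ℚ
  height u v x = dot u (toℚ ∘ v x)

  dot-diff : ∀ {m n} (u : Fin n → ℚ) (v : Fin m → Point n) j k →
             dot u (diff v j k) ≡ height u v j - height u v k
  dot-diff u v j k = trans
    (sumF-cong (λ r → solve 3 (λ c a b → c :* (a :- b) := c :* a :- c :* b) refl
                             (u r) (toℚ (v j r)) (toℚ (v k r))))
    (sumF-sub (λ r → u r * toℚ (v j r)) (λ r → u r * toℚ (v k r)))

  module _ {n} (v : Fin (suc n) → Point n) {i : Fin (suc n)} (u : Fin n → ℚ) where

    normal-level : InwardNormal v i u → ∀ j k → j ≢ i → k ≢ i → height u v j ≡ height u v k
    normal-level (level , _) j k j≢i k≢i =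
      x∙y⁻¹≈ε⇒x≈y _ _ (trans (sym (dot-diff u v j k)) (level j k j≢i k≢i))

    normal-above : InwardNormal v i u → ∀ j → j ≢ i → height u v j < height u v i
    normal-above (_ , above) j j≢i = 0<q-p⇒p<q (subst (0ℚ <_) (dot-diff u v i j) (above j j≢i))

    inwardNormal : (c : ℚ) → (∀ j → j ≢ i → height u v j ≡ c) → c < height u v i → InwardNormal v i u
    inwardNormal c at-c c<i = level , above
      where
      level : ∀ j k → j ≢ i → k ≢ i → dot u (diff v j k) ≡ 0ℚ
      level j k j≢i k≢i =
        trans (dot-diff u v j k) (x≈y⇒x∙y⁻¹≈ε (trans (at-c j j≢i) (sym (at-c k k≢i))))
      above : ∀ j → j ≢ i → 0ℚ < dot u (diff v i j)
      above j j≢i = subst (0ℚ <_) (sym (dot-diff u v i j))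
                          (p<q⇒0<q-p (subst (_< height u v i) (sym (at-c j j≢i)) c<i))

  -- Pyramids

  inject₁≢fromℕ : ∀ {n} {i : Fin n} → inject₁ i ≢ fromℕ n
  inject₁≢fromℕ = fromℕ≢inject₁ ∘ sym

  -- v is the pyramid over base × {0} with apex (apex, d).
  record Extension {n} (v : Fin (suc (suc n)) → Point (suc n))
                   (base : Fin (suc n) → Point n) (apex : Point n) (d : Bool) : Set where
    field
      base-init : ∀ a r → init (v (inject₁ a)) r ≡ base a r
      base-last : ∀ a → last (v (inject₁ a)) ≡ false
      apex-init : ∀ r → init (last v) r ≡ apex r
      apex-last : last (last v) ≡ d

  combination : ∀ {n} → (Fin (suc n) → Point n) → (Fin n → ℚ) → Fin n → ℚ
  combination v c r = sumF (λ j → c j * diff v (fsuc j) fzero r)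

  combination-cong : ∀ {n} (v : Fin (suc n) → Point n) {c c′ : Fin n → ℚ} → c ≗ c′ →
                     combination v c ≗ combination v c′
  combination-cong v c≗c′ r = sumF-cong (λ j → cong (_* diff v (fsuc j) fzero r) (c≗c′ j))

  module _ {n} {v : Fin (suc (suc n)) → Point (suc n)} {base apex d} (E : Extension v base apex d) where
    open Extension E

    height-base : ∀ (u : Fin (suc n) → ℚ) a → height u v (inject₁ a) ≡ height (init u) base a
    height-base u a = begin
      height u v (inject₁ a)
        ≡⟨ dot-init-last u (toℚ ∘ v (inject₁ a)) ⟩
      dot (init u) (toℚ ∘ init (v (inject₁ a))) + last u * toℚ (last (v (inject₁ a)))
        ≡⟨ cong₂ _+_ (dot-congʳ (init u) (cong toℚ ∘ base-init a))
                     (cong (λ b → last u * toℚ b) (base-last a)) ⟩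
      height (init u) base a + last u * 0ℚ
        ≡⟨ trans (cong (height (init u) base a +_) (*-zeroʳ (last u))) (+-identityʳ _) ⟩
      height (init u) base a ∎
      where open ≡-Reasoning

    height-apex : ∀ (u : Fin (suc n) → ℚ) →
                  height u v (fromℕ (suc n)) ≡ dot (init u) (toℚ ∘ apex) + last u * toℚ d
    height-apex u = trans (dot-init-last u (toℚ ∘ last v))
      (cong₂ _+_ (dot-congʳ (init u) (cong toℚ ∘ apex-init)) (cong (λ b → last u * toℚ b) apex-last))

    height-∷ʳ-base : ∀ (u : Fin n → ℚ) α a → height (u ∷ʳ α) v (inject₁ a) ≡ height u base a
    height-∷ʳ-base u α a = trans (height-base (u ∷ʳ α) a) (dot-congˡ (toℚ ∘ base a) (init-∷ʳ u α))

    height-∷ʳ-apex : ∀ (u : Fin n → ℚ) α →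
                     height (u ∷ʳ α) v (fromℕ (suc n)) ≡ dot u (toℚ ∘ apex) + α * toℚ d
    height-∷ʳ-apex u α = trans (height-apex (u ∷ʳ α))
      (cong₂ _+_ (dot-congˡ (toℚ ∘ apex) (init-∷ʳ u α)) (cong (_* toℚ d) (last-∷ʳ u α)))

    diff-base : ∀ j k r → diff v (inject₁ j) (inject₁ k) (inject₁ r) ≡ diff base j k r
    diff-base j k r = cong₂ _-_ (cong toℚ (base-init j r)) (cong toℚ (base-init k r))

    combination-base : ∀ c r → combination v c (inject₁ r)
                             ≡ combination base (init c) r + last c * (toℚ (apex r) - toℚ (base fzero r))
    combination-base c r = trans (sumF-init-last (λ j → c j * diff v (fsuc j) fzero (inject₁ r)))
      (cong₂ _+_ (sumF-cong (λ j → cong (init c j *_) (diff-base (fsuc j) fzero r)))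
                 (cong (last c *_) (cong₂ _-_ (cong toℚ (apex-init r)) (cong toℚ (base-init fzero r)))))

    combination-last : ∀ c → combination v c (fromℕ n) ≡ last c * toℚ d
    combination-last c = begin
      combination v c (fromℕ n)
        ≡⟨ sumF-init-last (λ j → c j * diff v (fsuc j) fzero (fromℕ n)) ⟩
      sumF (λ j → init c j * diff v (inject₁ (fsuc j)) fzero (fromℕ n))
        + last c * diff v (fromℕ (suc n)) fzero (fromℕ n)
        ≡⟨ cong₂ _+_ (sumF-zero (λ j → trans (cong (init c j *_) (flat j)) (*-zeroʳ (init c j))))
                     (cong (last c *_) (cong₂ _-_ (cong toℚ apex-last) (cong toℚ (base-last fzero)))) ⟩
      0ℚ + last c * (toℚ d - 0ℚ)
        ≡⟨ trans (+-identityˡ _) (cong (last c *_) (+-identityʳ (toℚ d))) ⟩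
      last c * toℚ d ∎
      where
      open ≡-Reasoning
      flat : ∀ j → diff v (inject₁ (fsuc j)) fzero (fromℕ n) ≡ 0ℚ
      flat j = cong₂ _-_ (cong toℚ (base-last (fsuc j))) (cong toℚ (base-last fzero))

    combination-base₀ : ∀ c → last c ≡ 0ℚ → ∀ r → combination v c (inject₁ r) ≡ combination base (init c) r
    combination-base₀ c last-c≡0 r = begin
      combination v c (inject₁ r)               ≡⟨ combination-base c r ⟩
      combination base (init c) r + last c * w  ≡⟨ cong (λ x → combination base (init c) r + x * w) last-c≡0 ⟩
      combination base (init c) r + 0ℚ * w      ≡⟨ cong (combination base (init c) r +_) (*-zeroˡ w) ⟩
      combination base (init c) r + 0ℚ          ≡⟨ +-identityʳ _ ⟩
      combination base (init c) r               ∎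
      where
      open ≡-Reasoning
      w = toℚ (apex r) - toℚ (base fzero r)

    AffIndep-base : AffIndep v → AffIndep base
    AffIndep-base indep c c-trivial j = trans (sym (init-∷ʳ c 0ℚ j)) (indep (c ∷ʳ 0ℚ) trivial (inject₁ j))
      where
      trivial : ∀ k → combination v (c ∷ʳ 0ℚ) k ≡ 0ℚ
      trivial = init-last-elim
        (λ r → trans (combination-base₀ (c ∷ʳ 0ℚ) (last-∷ʳ c 0ℚ) r)
                     (trans (combination-cong base (init-∷ʳ c 0ℚ) r) (c-trivial r)))
        (trans (combination-last (c ∷ʳ 0ℚ)) (trans (cong (_* toℚ d) (last-∷ʳ c 0ℚ)) (*-zeroˡ (toℚ d))))

    normal-base : ∀ {a} (u : Fin (suc n) → ℚ) → InwardNormal v (inject₁ a) u →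
                  InwardNormal base a (init u)
    normal-base {a} u N = inwardNormal base (init u) (height u v (fromℕ (suc n))) level above
      where
      level : ∀ j → j ≢ a → height (init u) base j ≡ height u v (fromℕ (suc n))
      level j j≢a = trans (sym (height-base u j))
        (normal-level v u N (inject₁ j) (fromℕ (suc n)) (j≢a ∘ inject₁-injective) (inject₁≢fromℕ ∘ sym))
      above : height u v (fromℕ (suc n)) < height (init u) base a
      above = subst (height u v (fromℕ (suc n)) <_) (height-base u a)
                    (normal-above v u N _ (inject₁≢fromℕ ∘ sym))

  module _ {n} {v : Fin (suc (suc n)) → Point (suc n)} {base apex} (E : Extension v base apex true) where
    open Extension E

    apex-normal : InwardNormal v (fromℕ (suc n)) lastUnit
    apex-normal = inwardNormal v lastUnit 0ℚ level-0 (subst (0ℚ <_) (sym apex-1) (positive⁻¹ 1ℚ))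
      where
      level-0 : ∀ j → j ≢ fromℕ (suc n) → height lastUnit v j ≡ 0ℚ
      level-0 j j≢apex with view j
      ... | ‵inject₁ a = trans (height-∷ʳ-base E (λ _ → 0ℚ) 1ℚ a) (dot-zeroˡ (toℚ ∘ base a))
      ... | ‵fromℕ = ⊥-elim (j≢apex refl)
      apex-1 : height lastUnit v (fromℕ (suc n)) ≡ 1ℚ
      apex-1 = trans (height-∷ʳ-apex E (λ _ → 0ℚ) 1ℚ) (cong (_+ 1ℚ) (dot-zeroˡ (toℚ ∘ apex)))

    -- The last coordinate is chosen so that the apex lies on the level c of the facet.
    lift-normal : ∀ {k} (u : Fin n → ℚ) (c : ℚ) → (∀ j → j ≢ k → height u base j ≡ c) → c < height u base k →
                  InwardNormal v (inject₁ k) (u ∷ʳ (c - dot u (toℚ ∘ apex)))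
    lift-normal {k} u c level-c c<k =
      inwardNormal v (u ∷ʳ α) c level-c′ (subst (c <_) (sym (height-∷ʳ-base E u α k)) c<k)
      where
      α = c - dot u (toℚ ∘ apex)
      level-c′ : ∀ j → j ≢ inject₁ k → height (u ∷ʳ α) v j ≡ c
      level-c′ j j≢k with view j
      ... | ‵inject₁ a = trans (height-∷ʳ-base E u α a) (level-c a (j≢k ∘ cong inject₁))
      ... | ‵fromℕ = trans (height-∷ʳ-apex E u α)
        (solve 2 (λ D c → D :+ (c :- D) :* con 1ℚ := c) refl (dot u (toℚ ∘ apex)) c)

    lift-last-nonPos : Nonobtuse v → ∀ {k} (u : Fin n → ℚ) α →
                       InwardNormal v (inject₁ k) (u ∷ʳ α) → α ≤ 0ℚ
    lift-last-nonPos nonobtuse u α N = subst (_≤ 0ℚ) (dot-∷ʳ-lastUnit u α)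
      (nonobtuse _ (fromℕ (suc n)) inject₁≢fromℕ (u ∷ʳ α) lastUnit N apex-normal)

    Nonobtuse-base : Nonobtuse v → Nonobtuse base
    Nonobtuse-base nonobtuse i i′ i≢i′ u w Nu Nw = x+y≤0⇒x≤0 (nonPos*nonPos≥0 α≤0 β≤0) sum≤0
      where
      α = height u base i′ - dot u (toℚ ∘ apex)
      β = height w base i - dot w (toℚ ∘ apex)
      U : InwardNormal v (inject₁ i) (u ∷ʳ α)
      U = lift-normal u (height u base i′) (λ j j≢i → normal-level base u Nu j i′ j≢i (i≢i′ ∘ sym))
                      (normal-above base u Nu i′ (i≢i′ ∘ sym))
      W : InwardNormal v (inject₁ i′) (w ∷ʳ β)
      W = lift-normal w (height w base i) (λ j j≢i′ → normal-level base w Nw j i j≢i′ i≢i′)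
                      (normal-above base w Nw i i≢i′)
      α≤0 = lift-last-nonPos nonobtuse u α U
      β≤0 = lift-last-nonPos nonobtuse w β W
      sum≤0 : dot u w + α * β ≤ 0ℚ
      sum≤0 = subst (_≤ 0ℚ) (dot-∷ʳ u α w β)
        (nonobtuse (inject₁ i) (inject₁ i′) (i≢i′ ∘ inject₁-injective) (u ∷ʳ α) (w ∷ʳ β) U W)

  module _ {n} {v : Fin (suc (suc n)) → Point (suc n)} {base} {q : Fin (suc n)}
           (E : Extension v base (base q) true) where

    last≡apex-rise : ∀ (u : Fin (suc n) → ℚ) →
                     last u ≡ height u v (fromℕ (suc n)) - height u v (inject₁ q)
    last≡apex-rise u = begin
      last u
        ≡⟨ solve 2 (λ a h → a := (h :+ a :* con 1ℚ) :- h) refl (last u) (height (init u) base q) ⟩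
      (height (init u) base q + last u * 1ℚ) - height (init u) base q
        ≡⟨ cong₂ _-_ (sym (height-apex E u)) (sym (height-base E u q)) ⟩
      height u v (fromℕ (suc n)) - height u v (inject₁ q) ∎
      where open ≡-Reasoning

    normal-last≡0 : ∀ {a} (u : Fin (suc n) → ℚ) → InwardNormal v (inject₁ a) u → a ≢ q → last u ≡ 0ℚ
    normal-last≡0 u N a≢q = trans (last≡apex-rise u) (x≈y⇒x∙y⁻¹≈ε
      (normal-level v u N _ (inject₁ q) (inject₁≢fromℕ ∘ sym) (a≢q ∘ sym ∘ inject₁-injective)))

    normal-last≤0 : ∀ {b} (u : Fin (suc n) → ℚ) → InwardNormal v (inject₁ b) u → last u ≤ 0ℚ
    normal-last≤0 {b} u N with b ≟ q
    ... | yes refl = subst (_≤ 0ℚ) (sym (last≡apex-rise u))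
                           (p≤q⇒p-q≤0 (<⇒≤ (normal-above v u N _ (inject₁≢fromℕ ∘ sym))))
    ... | no b≢q   = ≤-reflexive (normal-last≡0 u N b≢q)

    apex-normal-last>0 : ∀ (u : Fin (suc n) → ℚ) → InwardNormal v (fromℕ (suc n)) u → 0ℚ < last u
    apex-normal-last>0 u N = subst (0ℚ <_) (sym (last≡apex-rise u))
                                   (p<q⇒0<q-p (normal-above v u N (inject₁ q) inject₁≢fromℕ))

    dot-normals-base : ∀ {a b} (u w : Fin (suc n) → ℚ) → a ≢ b →
                       InwardNormal v (inject₁ a) u → InwardNormal v (inject₁ b) w →
                       dot u w ≡ dot (init u) (init w)
    dot-normals-base {a} {b} u w a≢b Nu Nw =
      trans (dot-init-last u w) (trans (cong (dot (init u) (init w) +_) last-product≡0) (+-identityʳ _))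
      where
      last-product≡0 : last u * last w ≡ 0ℚ
      last-product≡0 with a ≟ q
      ... | yes refl = trans (cong (last u *_) (normal-last≡0 w Nw (a≢b ∘ sym))) (*-zeroʳ (last u))
      ... | no a≢q   = trans (cong (_* last w) (normal-last≡0 u Nu a≢q)) (*-zeroˡ (last w))

  -- Stacked simplices

  data Stacked : (n : ℕ) → (Fin (suc n) → Point n) → Set where
    point : (v : Fin 1 → Point 0) → Stacked 0 v
    stack : ∀ {n v} {base : Fin (suc n) → Point n} →
            Stacked n base → (q : Fin (suc n)) → Extension v base (base q) true → Stacked (suc n) v

  Stacked-resp : ∀ {n v w} → Stacked n v → (∀ a → v a ≗ w a) → Stacked n w
  Stacked-resp (point v) v≗w = point _
  Stacked-resp (stack T q E) v≗w = stack T q record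
    { base-init = λ a r → trans (sym (v≗w _ _)) (base-init a r)
    ; base-last = λ a → trans (sym (v≗w _ _)) (base-last a)
    ; apex-init = λ r → trans (sym (v≗w _ _)) (apex-init r)
    ; apex-last = trans (sym (v≗w _ _)) apex-last
    }
    where open Extension E

  Stacked⇒AffIndep : ∀ {n v} → Stacked n v → AffIndep v
  Stacked⇒AffIndep (point v) c trivial ()
  Stacked⇒AffIndep (stack {n} {v} {base} T q E) c trivial = init-last-elim init-c≡0 last-c≡0
    where
    last-c≡0 : last c ≡ 0ℚ
    last-c≡0 = trans (sym (*-identityʳ (last c))) (trans (sym (combination-last E c)) (trivial (fromℕ n)))
    init-c≡0 : ∀ j → init c j ≡ 0ℚ
    init-c≡0 = Stacked⇒AffIndep T (init c) (λ r →
      trans (sym (combination-base₀ E c last-c≡0 r)) (trivial (inject₁ r)))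

  Stacked-level⇒0 : ∀ {n v} → Stacked n v → (u : Fin n → ℚ) →
                    (∀ x → height u v x ≡ height u v fzero) → ∀ r → u r ≡ 0ℚ
  Stacked-level⇒0 (point v) u level ()
  Stacked-level⇒0 (stack {n} {v} T q E) u level = init-last-elim init-u≡0 last-u≡0
    where
    init-u≡0 : ∀ r → init u r ≡ 0ℚ
    init-u≡0 = Stacked-level⇒0 T (init u) (λ x →
      trans (sym (height-base E u x)) (trans (level (inject₁ x)) (height-base E u fzero)))
    last-u≡0 : last u ≡ 0ℚ
    last-u≡0 = trans (last≡apex-rise E u) (x≈y⇒x∙y⁻¹≈ε (trans (level _) (sym (level (inject₁ q)))))

  apex-angle : ∀ {n v base} {q : Fin (suc n)} → Stacked n base → (E : Extension v base (base q) true) →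
               ∀ {b} (u w : Fin (suc n) → ℚ) → InwardNormal v (fromℕ (suc n)) u → InwardNormal v (inject₁ b) w →
               dot u w ≤ 0ℚ
  apex-angle {v = v} {base} T E u w Nu Nw =
    subst (_≤ 0ℚ) (sym dot≡) (nonNeg*nonPos≤0 (<⇒≤ (apex-normal-last>0 E u Nu)) (normal-last≤0 E w Nw))
    where
    init-u≡0 : ∀ r → init u r ≡ 0ℚ
    init-u≡0 = Stacked-level⇒0 T (init u) (λ x → trans (sym (height-base E u x))
      (trans (normal-level v u Nu (inject₁ x) (inject₁ fzero) inject₁≢fromℕ inject₁≢fromℕ) (height-base E u fzero)))
    dot≡ : dot u w ≡ last u * last w
    dot≡ = trans (dot-init-last u w)
      (trans (cong (_+ last u * last w) (trans (dot-congˡ (init w) init-u≡0) (dot-zeroˡ (init w))))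
             (+-identityˡ _))

  Stacked⇒Nonobtuse : ∀ {n v} → Stacked n v → Nonobtuse v
  Stacked⇒Nonobtuse (point v) fzero fzero 0≢0 = ⊥-elim (0≢0 refl)
  Stacked⇒Nonobtuse (stack T q E) i i′ i≢i′ u w Nu Nw with view i | view i′
  ... | ‵inject₁ a | ‵inject₁ b = subst (_≤ 0ℚ) (sym (dot-normals-base E u w a≢b Nu Nw))
    (Stacked⇒Nonobtuse T a b a≢b (init u) (init w) (normal-base E u Nu) (normal-base E w Nw))
    where a≢b = i≢i′ ∘ cong inject₁
  ... | ‵inject₁ a | ‵fromℕ    = subst (_≤ 0ℚ) (dot-comm w u) (apex-angle T E w u Nw Nu)
  ... | ‵fromℕ    | ‵inject₁ b = apex-angle T E u w Nu Nw
  ... | ‵fromℕ    | ‵fromℕ    = ⊥-elim (i≢i′ refl)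

  -- Barycentric coordinates

  δ : ∀ {n} → Fin n → Fin n → ℚ
  δ fzero    fzero    = 1ℚ
  δ fzero    (fsuc _) = 0ℚ
  δ (fsuc _) fzero    = 0ℚ
  δ (fsuc i) (fsuc j) = δ i j

  δ-refl : ∀ {n} (i : Fin n) → δ i i ≡ 1ℚ
  δ-refl fzero    = refl
  δ-refl (fsuc i) = δ-refl i

  δ-≢ : ∀ {n} {i j : Fin n} → i ≢ j → δ i j ≡ 0ℚ
  δ-≢ {i = fzero}  {fzero}  0≢0 = ⊥-elim (0≢0 refl)
  δ-≢ {i = fzero}  {fsuc j} _   = refl
  δ-≢ {i = fsuc i} {fzero}  _   = refl
  δ-≢ {i = fsuc i} {fsuc j} i≢j = δ-≢ (i≢j ∘ cong fsuc)

  δ-inject₁ : ∀ {n} (i j : Fin n) → δ (inject₁ i) (inject₁ j) ≡ δ i j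
  δ-inject₁ fzero    fzero    = refl
  δ-inject₁ fzero    (fsuc j) = refl
  δ-inject₁ (fsuc i) fzero    = refl
  δ-inject₁ (fsuc i) (fsuc j) = δ-inject₁ i j

  δ-nonNeg : ∀ {n} (i j : Fin n) → 0ℚ ≤ δ i j
  δ-nonNeg fzero    fzero    = <⇒≤ (positive⁻¹ 1ℚ)
  δ-nonNeg fzero    (fsuc j) = ≤-refl
  δ-nonNeg (fsuc i) fzero    = ≤-refl
  δ-nonNeg (fsuc i) (fsuc j) = δ-nonNeg i j

  toℚ-nonNeg : ∀ b → 0ℚ ≤ toℚ b
  toℚ-nonNeg false = ≤-refl
  toℚ-nonNeg true  = <⇒≤ (positive⁻¹ 1ℚ)

  functional : ∀ {n v} → Stacked n v → (Fin (suc n) → ℚ) → Fin n → ℚ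
  functional (point v)     φ ()
  functional (stack T q E) φ = functional T (init φ) ∷ʳ (last φ - φ (inject₁ q))

  functional-cong : ∀ {n v} (T : Stacked n v) {φ ψ : Fin (suc n) → ℚ} → φ ≗ ψ →
                    functional T φ ≗ functional T ψ
  functional-cong (point v)     φ≗ψ ()
  functional-cong (stack T q E) φ≗ψ =
    ∷ʳ-cong (functional-cong T (φ≗ψ ∘ inject₁)) (cong₂ _-_ (φ≗ψ _) (φ≗ψ _))

  height-functional : ∀ {n v} (T : Stacked n v) φ x → height (functional T φ) v x ≡ φ x - φ fzero
  height-functional (point v) φ fzero = sym (+-inverseʳ (φ fzero))
  height-functional (stack {n} {v} {base} T q E) φ = init-last-elim at-base at-apex
    where
    F = functional T (init φ)
    α = last φ - φ (inject₁ q)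
    at-base : ∀ a → height (F ∷ʳ α) v (inject₁ a) ≡ φ (inject₁ a) - φ fzero
    at-base a = trans (height-∷ʳ-base E F α a) (height-functional T (init φ) a)
    at-apex : height (F ∷ʳ α) v (fromℕ (suc n)) ≡ last φ - φ fzero
    at-apex = begin
      height (F ∷ʳ α) v (fromℕ (suc n))
        ≡⟨ height-∷ʳ-apex E F α ⟩
      height F base q + α * 1ℚ
        ≡⟨ cong₂ _+_ (height-functional T (init φ) q) (*-identityʳ α) ⟩
      (φ (inject₁ q) - φ fzero) + (last φ - φ (inject₁ q))
        ≡⟨ solve 3 (λ a b c → (a :- b) :+ (c :- a) := c :- b) refl (φ (inject₁ q)) (φ fzero) (last φ) ⟩
      last φ - φ fzero ∎
      where open ≡-Reasoning

  -- Since functional T (δ i) has height δ i x - δ i 0 at the vertex v x, this is the i-th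
  -- barycentric coordinate of p with respect to v.
  barycentric : ∀ {n v} → Stacked n v → Point n → Fin (suc n) → ℚ
  barycentric T p i = δ i fzero + dot (functional T (δ i)) (toℚ ∘ p)

  barycentric-vertex : ∀ {n v} (T : Stacked n v) i x → barycentric T (v x) i ≡ δ i x
  barycentric-vertex T i x = trans (cong (δ i fzero +_) (height-functional T (δ i) x))
    (solve 2 (λ a b → a :+ (b :- a) := b) refl (δ i fzero) (δ i x))

  barycentric-cong : ∀ {n v} (T : Stacked n v) {p p′ : Point n} → p ≗ p′ → barycentric T p ≗ barycentric T p′
  barycentric-cong T p≗p′ i = cong (δ i fzero +_) (dot-congʳ (functional T (δ i)) (cong toℚ ∘ p≗p′))

  module _ {n v base} {q : Fin (suc n)} (T : Stacked n base) (E : Extension v base (base q) true) where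
    open Extension E

    barycentric-init : ∀ (p : Point (suc n)) i →
                       barycentric T (init p) i ≡ barycentric (stack T q E) p (inject₁ i) + δ i q * toℚ (last p)
    barycentric-init p i = begin
      barycentric T (init p) i
        ≡⟨ solve 4 (λ a D b x → a :+ D := (a :+ (D :+ (:- b) :* x)) :+ b :* x) refl
                   (δ i fzero) D (δ i q) X ⟩
      (δ i fzero + (D + (- δ i q) * X)) + δ i q * X
        ≡⟨ cong (_+ δ i q * X) (sym unfold) ⟩
      barycentric (stack T q E) p (inject₁ i) + δ i q * X ∎
      where
      open ≡-Reasoning
      X = toℚ (last p)
      D = dot (functional T (δ i)) (toℚ ∘ init p)
      last-coefficient : δ (inject₁ i) (fromℕ (suc n)) - δ (inject₁ i) (inject₁ q) ≡ - δ i q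
      last-coefficient = trans (cong₂ _-_ (δ-≢ (inject₁≢fromℕ {i = i})) (δ-inject₁ i q)) (+-identityˡ _)
      unfold : barycentric (stack T q E) p (inject₁ i) ≡ δ i fzero + (D + (- δ i q) * X)
      unfold = cong₂ _+_ (δ-inject₁ i fzero)
        (trans (dot-∷ʳˡ _ _ (toℚ ∘ p))
               (cong₂ _+_ (dot-congˡ (toℚ ∘ init p) (functional-cong T (δ-inject₁ i)))
                          (cong (_* X) last-coefficient)))

    -- If p has last coordinate 1, its barycentric coordinate at q is δ q x - 1, which forces x = q.
    lift-vertex : ∀ (p : Point (suc n)) x → init p ≗ base x →
                  (∀ i → 0ℚ ≤ barycentric (stack T q E) p i) → ∃ λ y → p ≗ v y
    lift-vertex p x init-p≗base-x nonNeg with last p in last-p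
    ... | false = inject₁ x , init-last-elim (λ r → trans (init-p≗base-x r) (sym (base-init x r)))
                                             (trans last-p (sym (base-last x)))
    ... | true  = fromℕ (suc n) , init-last-elim
                    (λ r → trans (init-p≗base-x r) (trans (cong (λ y → base y r) (sym q≡x)) (sym (apex-init r))))
                    (trans last-p (sym apex-last))
      where
      at-q : barycentric (stack T q E) p (inject₁ q) ≡ δ q x - 1ℚ
      at-q = begin
        barycentric (stack T q E) p (inject₁ q)
          ≡⟨ solve 2 (λ b c → b := (b :+ c) :- c) refl _ (δ q q * toℚ (last p)) ⟩
        (barycentric (stack T q E) p (inject₁ q) + δ q q * toℚ (last p)) - δ q q * toℚ (last p)
          ≡⟨ cong₂ _-_ (sym (barycentric-init p q)) (cong₂ _*_ (δ-refl q) (cong toℚ last-p)) ⟩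
        barycentric T (init p) q - 1ℚ * 1ℚ
          ≡⟨ cong (_- 1ℚ) (trans (barycentric-cong T init-p≗base-x q) (barycentric-vertex T q x)) ⟩
        δ q x - 1ℚ ∎
        where open ≡-Reasoning
      q≡x : q ≡ x
      q≡x with q ≟ x
      ... | yes q≡x = q≡x
      ... | no  q≢x = ⊥-elim (<-irrefl refl (<-≤-trans (negative⁻¹ (- 1ℚ))
                                (subst (0ℚ ≤_) (trans at-q (cong (_- 1ℚ) (δ-≢ q≢x))) (nonNeg (inject₁ q)))))

  barycentric-nonNeg⇒vertex : ∀ {n v} (T : Stacked n v) (p : Point n) →
                              (∀ i → 0ℚ ≤ barycentric T p i) → ∃ λ x → p ≗ v x
  barycentric-nonNeg⇒vertex (point v)     p nonNeg = fzero , λ ()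
  barycentric-nonNeg⇒vertex (stack T q E) p nonNeg =
    let x , init-p≗base-x = barycentric-nonNeg⇒vertex T (init p) nonNeg-init in
    lift-vertex T E p x init-p≗base-x nonNeg
    where
    nonNeg-init : ∀ i → 0ℚ ≤ barycentric T (init p) i
    nonNeg-init i = subst (0ℚ ≤_) (sym (barycentric-init T E p i))
      (+-mono-≤ (nonNeg (inject₁ i)) (nonNeg*nonNeg≥0 (δ-nonNeg i q) (toℚ-nonNeg (last p))))

  Nonobtuse⇒barycentric-nonNeg : ∀ {n v base apex} (T : Stacked n base) → Extension v base apex true →
                                 Nonobtuse v → ∀ i → 0ℚ ≤ barycentric T apex i
  Nonobtuse⇒barycentric-nonNeg {v = v} {base} {apex} T E nonobtuse i =
    -p≤0⇒0≤p (subst (_≤ 0ℚ) lift-coordinate (lift-last-nonPos E nonobtuse F α N))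
    where
    F = functional T (δ i)
    c = - δ i fzero
    α = c - dot F (toℚ ∘ apex)
    level : ∀ j → j ≢ i → height F base j ≡ c
    level j j≢i = trans (height-functional T (δ i) j)
                        (trans (cong (_- δ i fzero) (δ-≢ (j≢i ∘ sym))) (+-identityˡ c))
    above : c < height F base i
    above = 0<q-p⇒p<q (subst (0ℚ <_) rise (positive⁻¹ 1ℚ))
      where
      rise : 1ℚ ≡ height F base i - c
      rise = sym (trans (cong (_- c) (trans (height-functional T (δ i) i) (cong (_- δ i fzero) (δ-refl i))))
                        (solve 1 (λ a → (con 1ℚ :- a) :- (:- a) := con 1ℚ) refl (δ i fzero)))
    N : InwardNormal v (inject₁ i) (F ∷ʳ α)
    N = lift-normal E F c level above
    lift-coordinate : α ≡ - barycentric T apex i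
    lift-coordinate = solve 2 (λ a D → (:- a) :- D := :- (a :+ D)) refl (δ i fzero) (dot F (toℚ ∘ apex))

  Nonobtuse⇒apex-vertex : ∀ {n v base apex} → Stacked n base → Extension v base apex true →
                          (2 ℕ.≤ suc n → Nonobtuse v) → ∃ λ x → apex ≗ base x
  Nonobtuse⇒apex-vertex {zero}  T E _          = fzero , λ ()
  Nonobtuse⇒apex-vertex {suc n} T E nonobtuse =
    barycentric-nonNeg⇒vertex T _ (Nonobtuse⇒barycentric-nonNeg T E (nonobtuse (s≤s (s≤s z≤n))))

  false≢true : false ≢ true
  false≢true ()

  Stacked-vertex-injective : ∀ {n v} → Stacked n v → ∀ a b → v a ≗ v b → a ≡ b
  Stacked-vertex-injective (point v) fzero fzero _ = refl
  Stacked-vertex-injective (stack {n} T q E) a b va≗vb with view a | view b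
  ... | ‵inject₁ a′ | ‵inject₁ b′ = cong inject₁ (Stacked-vertex-injective T a′ b′
          (λ r → trans (sym (base-init a′ r)) (trans (va≗vb (inject₁ r)) (base-init b′ r))))
    where open Extension E
  ... | ‵inject₁ a′ | ‵fromℕ =
    ⊥-elim (false≢true (trans (sym (base-last a′)) (trans (va≗vb (fromℕ n)) apex-last)))
    where open Extension E
  ... | ‵fromℕ | ‵inject₁ b′ =
    ⊥-elim (false≢true (trans (sym (base-last b′)) (trans (sym (va≗vb (fromℕ n))) apex-last)))
    where open Extension E
  ... | ‵fromℕ | ‵fromℕ = refl

  punchIn-fromℕ : ∀ {n} (j : Fin n) → punchIn (fromℕ n) j ≡ inject₁ j
  punchIn-fromℕ {suc n} fzero    = refl
  punchIn-fromℕ {suc n} (fsuc j) = cong fsuc (punchIn-fromℕ j)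

  Stacked⇒Orthogonal : ∀ {m v} → Stacked (suc m) v → Orthogonal (suc m) v
  Stacked⇒Orthogonal {zero}  {v} T = segment v (Stacked⇒AffIndep T)
  Stacked⇒Orthogonal {suc m} {v} T@(stack T′ q E) =
    step v (Stacked⇒AffIndep T) (Stacked⇒Nonobtuse T) (fromℕ (suc (suc m))) (fromℕ (suc m)) false
      (λ j → trans (cong (λ y → last (v y)) (punchIn-fromℕ j)) (base-last j))
      (Stacked⇒Orthogonal (Stacked-resp T′ (λ a r →
        trans (sym (base-init a r)) (cong₂ v (sym (punchIn-fromℕ a)) (sym (punchIn-fromℕ r))))))
    where open Extension E

  Orthogonal⇒AffIndep : ∀ {n v} → Orthogonal n v → AffIndep v
  Orthogonal⇒AffIndep (segment v indep)          = indep
  Orthogonal⇒AffIndep (step v indep _ _ _ _ _ _) = indep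

  Orthogonal⇒Nonobtuse : ∀ {n v} → Orthogonal n v → 2 ℕ.≤ n → Nonobtuse v
  Orthogonal⇒Nonobtuse (segment v _) (s≤s ())
  Orthogonal⇒Nonobtuse (step v _ nonobtuse _ _ _ _ _) _ = nonobtuse

  -- Upper triangular matrices

  matrix : ∀ {n} → (Fin n → Fin n → Bool) → Matrix n
  matrix f = tabulate (λ i → tabulate (f i))

  entry-matrix : ∀ {n} (f : Fin n → Fin n → Bool) i j → entry (matrix f) i j ≡ f i j
  entry-matrix f i j = trans (cong (λ row → lookup row j) (lookup∘tabulate _ i)) (lookup∘tabulate (f i) j)

  matrix-ext : ∀ {n} {P Q : Matrix n} → (∀ i j → entry P i j ≡ entry Q i j) → P ≡ Q
  matrix-ext {P = P} {Q} P≡Q = trans (sym (tabulate∘lookup P))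
    (trans (tabulate-cong (λ i →
             trans (sym (tabulate∘lookup _)) (trans (tabulate-cong (P≡Q i)) (tabulate∘lookup _))))
           (tabulate∘lookup Q))

  leading : ∀ {n} → Matrix (suc n) → Matrix n
  leading P = matrix (λ i j → entry P (inject₁ i) (inject₁ j))

  lastColumn : ∀ {n} → Matrix (suc n) → Point n
  lastColumn {n} P i = entry P (inject₁ i) (fromℕ n)

  border : ∀ {n} → Matrix n → Point n → Matrix (suc n)
  border P col = matrix ((λ i → entry P i ∷ʳ col i) ∷ʳ ((λ _ → false) ∷ʳ true))

  inject₁<fromℕ : ∀ {n} (j : Fin n) → inject₁ j <ᶠ fromℕ n
  inject₁<fromℕ {n} j = subst (toℕ (inject₁ j) ℕ.<_) (sym (toℕ-fromℕ n)) (inject₁ℕ< j)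

  inject₁-mono-< : ∀ {n} {i j : Fin n} → j <ᶠ i → inject₁ j <ᶠ inject₁ i
  inject₁-mono-< {i = i} {j} = subst₂ ℕ._<_ (sym (toℕ-inject₁ j)) (sym (toℕ-inject₁ i))

  UpperTriangular-leading : ∀ {n} (P : Matrix (suc n)) → UpperTriangular P → UpperTriangular (leading P)
  UpperTriangular-leading P ut i j j<i =
    trans (entry-matrix _ i j) (ut (inject₁ i) (inject₁ j) (inject₁-mono-< j<i))

  vertsOf-Extension : ∀ {n} (P : Matrix (suc n)) → UpperTriangular P →
                      Extension (vertsOf P) (vertsOf (leading P)) (lastColumn P) (entry P (fromℕ n) (fromℕ n))
  vertsOf-Extension {n} P ut = record
    { base-init = base-init
    ; base-last = base-last
    ; apex-init = λ r → refl
    ; apex-last = refl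
    }
    where
    base-init : ∀ a r → vertsOf P (inject₁ a) (inject₁ r) ≡ vertsOf (leading P) a r
    base-init fzero    r = refl
    base-init (fsuc j) r = sym (entry-matrix _ r j)
    base-last : ∀ a → vertsOf P (inject₁ a) (fromℕ n) ≡ false
    base-last fzero    = refl
    base-last (fsuc j) = ut (fromℕ n) (inject₁ j) (inject₁<fromℕ j)

  module _ {n} (P : Matrix n) (col : Point n) where

    private
      upperRows : Fin n → Fin (suc n) → Bool
      upperRows i = entry P i ∷ʳ col i
      lastRow : Fin (suc n) → Bool
      lastRow = (λ _ → false) ∷ʳ true
      rows : Fin (suc n) → Fin (suc n) → Bool
      rows = upperRows ∷ʳ lastRow

    entry-border-init-init : ∀ i j → entry (border P col) (inject₁ i) (inject₁ j) ≡ entry P i j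
    entry-border-init-init i j = trans (entry-matrix rows (inject₁ i) (inject₁ j))
      (trans (cong (λ row → row (inject₁ j)) (init-∷ʳ upperRows lastRow i)) (init-∷ʳ (entry P i) (col i) j))

    entry-border-init-last : ∀ i → entry (border P col) (inject₁ i) (fromℕ n) ≡ col i
    entry-border-init-last i = trans (entry-matrix rows (inject₁ i) (fromℕ n))
      (trans (cong (λ row → row (fromℕ n)) (init-∷ʳ upperRows lastRow i)) (last-∷ʳ (entry P i) (col i)))

    entry-border-last-init : ∀ j → entry (border P col) (fromℕ n) (inject₁ j) ≡ false
    entry-border-last-init j = trans (entry-matrix rows (fromℕ n) (inject₁ j))
      (trans (cong (λ row → row (inject₁ j)) (last-∷ʳ upperRows lastRow)) (init-∷ʳ (λ _ → false) true j))

    entry-border-last-last : entry (border P col) (fromℕ n) (fromℕ n) ≡ true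
    entry-border-last-last = trans (entry-matrix rows (fromℕ n) (fromℕ n))
      (trans (cong (λ row → row (fromℕ n)) (last-∷ʳ upperRows lastRow)) (last-∷ʳ {n} (λ _ → false) true))

    leading-border : leading (border P col) ≡ P
    leading-border = matrix-ext (λ i j → trans (entry-matrix _ i j) (entry-border-init-init i j))

    border-Extension : Extension (vertsOf (border P col)) (vertsOf P) col true
    border-Extension = record
      { base-init = base-init
      ; base-last = base-last
      ; apex-init = entry-border-init-last
      ; apex-last = entry-border-last-last
      }
      where
      base-init : ∀ a r → vertsOf (border P col) (inject₁ a) (inject₁ r) ≡ vertsOf P a r
      base-init fzero    r = refl
      base-init (fsuc j) r = entry-border-init-init r j
      base-last : ∀ a → vertsOf (border P col) (inject₁ a) (fromℕ n) ≡ false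
      base-last fzero    = refl
      base-last (fsuc j) = entry-border-last-init j

    UpperTriangular-border : UpperTriangular P → UpperTriangular (border P col)
    UpperTriangular-border ut i j j<i with view i | view j
    ... | ‵inject₁ i′ | ‵inject₁ j′ =
      trans (entry-border-init-init i′ j′) (ut i′ j′ (subst₂ ℕ._<_ (toℕ-inject₁ j′) (toℕ-inject₁ i′) j<i))
    ... | ‵inject₁ i′ | ‵fromℕ     = ⊥-elim (ℕ.<-asym j<i (inject₁<fromℕ i′))
    ... | ‵fromℕ     | ‵inject₁ j′ = entry-border-last-init j′
    ... | ‵fromℕ     | ‵fromℕ     = ⊥-elim (ℕ.<-irrefl refl j<i)

  ≡border : ∀ {n} (P : Matrix (suc n)) {col} → UpperTriangular P → entry P (fromℕ n) (fromℕ n) ≡ true →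
            lastColumn P ≗ col → P ≡ border (leading P) col
  ≡border {n} P {col} ut last-diag last-column =
    matrix-ext (λ i j → init-last-elim (λ i′ → at-row i′ j) (at-last-row j) i)
    where
    at-row : ∀ i j → entry P (inject₁ i) j ≡ entry (border (leading P) col) (inject₁ i) j
    at-row i = init-last-elim
      (λ j → trans (sym (entry-matrix _ i j)) (sym (entry-border-init-init (leading P) col i j)))
      (trans (last-column i) (sym (entry-border-init-last (leading P) col i)))
    at-last-row : ∀ j → entry P (fromℕ n) j ≡ entry (border (leading P) col) (fromℕ n) j
    at-last-row = init-last-elim
      (λ j → trans (ut (fromℕ n) (inject₁ j) (inject₁<fromℕ j)) (sym (entry-border-last-init (leading P) col j)))
      (trans last-diag (sym (entry-border-last-last (leading P) col)))

  Spanning : ∀ {n} → (Fin (suc n) → Point n) → Set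
  Spanning {n} v = (a : Fin n → ℚ) → ∃ λ c → ∀ r → combination v c r ≡ a r

  unitUpperTriangular⇒Spanning : ∀ n (P : Matrix n) → UpperTriangular P → (∀ i → entry P i i ≡ true) →
                                 Spanning (vertsOf P)
  unitUpperTriangular⇒Spanning zero    P ut unit a = (λ ()) , λ ()
  unitUpperTriangular⇒Spanning (suc n) P ut unit a = c , init-last-elim at-init at-last
    where
    E = vertsOf-Extension P ut
    x = last a
    col = toℚ ∘ lastColumn P
    S = unitUpperTriangular⇒Spanning n (leading P) (UpperTriangular-leading P ut)
          (λ i → trans (entry-matrix _ i i) (unit (inject₁ i))) (λ r → init a r - x * col r)
    c = proj₁ S ∷ʳ x
    at-init : ∀ r → combination (vertsOf P) c (inject₁ r) ≡ a (inject₁ r)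
    at-init r = begin
      combination (vertsOf P) c (inject₁ r)
        ≡⟨ combination-base E c r ⟩
      combination (vertsOf (leading P)) (init c) r + last c * (col r - 0ℚ)
        ≡⟨ cong₂ _+_ (trans (combination-cong (vertsOf (leading P)) (init-∷ʳ (proj₁ S) x) r) (proj₂ S r))
                     (cong₂ _*_ (last-∷ʳ (proj₁ S) x) (+-identityʳ (col r))) ⟩
      (a (inject₁ r) - x * col r) + x * col r
        ≡⟨ solve 2 (λ a b → (a :- b) :+ b := a) refl (a (inject₁ r)) (x * col r) ⟩
      a (inject₁ r) ∎
      where open ≡-Reasoning
    at-last : combination (vertsOf P) c (fromℕ n) ≡ last a
    at-last = trans (combination-last E c)
      (trans (cong₂ _*_ (last-∷ʳ (proj₁ S) x) (cong toℚ (unit (fromℕ n)))) (*-identityʳ x))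

  -- If the last diagonal entry is 0, the last column is a combination of the other columns.
  zero-last-diagonal⇒¬AffIndep : ∀ {n} (P : Matrix (suc n)) → UpperTriangular P →
                                 (∀ i → entry (leading P) i i ≡ true) →
                                 entry P (fromℕ n) (fromℕ n) ≡ false → ¬ AffIndep (vertsOf P)
  zero-last-diagonal⇒¬AffIndep {n} P ut unit last-diag indep =
    1≢0 (trans (sym (last-∷ʳ s⁻ 1ℚ)) (indep (s⁻ ∷ʳ 1ℚ) trivial (fromℕ n)))
    where
    E = vertsOf-Extension P ut
    col = toℚ ∘ lastColumn P
    S = unitUpperTriangular⇒Spanning n (leading P) (UpperTriangular-leading P ut) unit col
    s⁻ = λ j → - proj₁ S j
    at-init : ∀ r → combination (vertsOf P) (s⁻ ∷ʳ 1ℚ) (inject₁ r) ≡ 0ℚ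
    at-init r = begin
      combination (vertsOf P) (s⁻ ∷ʳ 1ℚ) (inject₁ r)
        ≡⟨ combination-base E (s⁻ ∷ʳ 1ℚ) r ⟩
      combination (vertsOf (leading P)) (init (s⁻ ∷ʳ 1ℚ)) r + last (s⁻ ∷ʳ 1ℚ) * (col r - 0ℚ)
        ≡⟨ cong₂ _+_ (trans (combination-cong (vertsOf (leading P)) (init-∷ʳ s⁻ 1ℚ) r) negated-span)
                     (trans (cong₂ _*_ (last-∷ʳ s⁻ 1ℚ) (+-identityʳ (col r))) (*-identityˡ (col r))) ⟩
      - col r + col r
        ≡⟨ +-inverseˡ (col r) ⟩
      0ℚ ∎
      where
      open ≡-Reasoning
      negated-span : combination (vertsOf (leading P)) s⁻ r ≡ - col r
      negated-span = trans (sumF-cong (λ j → sym (neg-distribˡ-* (proj₁ S j) _)))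
                           (trans (sumF-neg (λ j → proj₁ S j * diff (vertsOf (leading P)) (fsuc j) fzero r))
                                  (cong -_ (proj₂ S r)))
    trivial : ∀ k → combination (vertsOf P) (s⁻ ∷ʳ 1ℚ) k ≡ 0ℚ
    trivial = init-last-elim at-init
      (trans (combination-last E (s⁻ ∷ʳ 1ℚ))
             (trans (cong (last (s⁻ ∷ʳ 1ℚ) *_) (cong toℚ last-diag)) (*-zeroʳ (last (s⁻ ∷ʳ 1ℚ)))))

  AffIndep⇒unit-diagonal : ∀ n (P : Matrix n) → UpperTriangular P → AffIndep (vertsOf P) →
                           ∀ i → entry P i i ≡ true
  AffIndep⇒unit-diagonal (suc n) P ut indep = init-last-elim init-diag last-diag
    where
    leading-unit : ∀ i → entry (leading P) i i ≡ true
    leading-unit = AffIndep⇒unit-diagonal n (leading P) (UpperTriangular-leading P ut)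
                     (AffIndep-base (vertsOf-Extension P ut) indep)
    init-diag : ∀ i → entry P (inject₁ i) (inject₁ i) ≡ true
    init-diag i = trans (sym (entry-matrix _ i i)) (leading-unit i)
    last-diag : entry P (fromℕ n) (fromℕ n) ≡ true
    last-diag with entry P (fromℕ n) (fromℕ n) in d
    ... | true  = refl
    ... | false = ⊥-elim (zero-last-diagonal⇒¬AffIndep P ut leading-unit d indep)

  -- The enumeration

  extensions : ∀ {n} → Matrix n → List (Matrix (suc n))
  extensions {n} P = map (λ q → border P (vertsOf P q)) (allFin (suc n))

  enumeration : ∀ n → List (Matrix n)
  enumeration zero    = [ [] ]
  enumeration (suc n) = concatMap extensions (enumeration n)

  length-concatMap-extensions : ∀ {n} (Ps : List (Matrix n)) →
                                length (concatMap extensions Ps) ≡ length Ps ℕ.* suc n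
  length-concatMap-extensions []           = refl
  length-concatMap-extensions {n} (P ∷ Ps) = trans (length-++ (extensions P))
    (cong₂ ℕ._+_ (trans (length-map _ (allFin (suc n))) (length-tabulate id)) (length-concatMap-extensions Ps))

  length-enumeration : ∀ n → length (enumeration n) ≡ n !
  length-enumeration zero    = refl
  length-enumeration (suc n) = trans (length-concatMap-extensions (enumeration n))
    (trans (cong (ℕ._* suc n) (length-enumeration n)) (ℕ.*-comm (n !) (suc n)))

  ∈-concatMap-extensions⁻ : ∀ {n} {M : Matrix (suc n)} (Ps : List (Matrix n)) → M ∈ concatMap extensions Ps →
                            ∃ λ P → P ∈ Ps × ∃ λ q → M ≡ border P (vertsOf P q)
  ∈-concatMap-extensions⁻ {n} Ps M∈ =
    let P , P∈Ps , M∈P = find (∈-concatMap⁻ extensions {xs = Ps} M∈)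
        q , _ , M≡ = ∈-map⁻ (λ q → border P (vertsOf P q)) {xs = allFin (suc n)} M∈P
    in P , P∈Ps , q , M≡

  ∈-concatMap-extensions⁺ : ∀ {n} {P : Matrix n} {Ps} → P ∈ Ps → ∀ q →
                            border P (vertsOf P q) ∈ concatMap extensions Ps
  ∈-concatMap-extensions⁺ {P = P} P∈Ps q =
    ∈-concatMap⁺ extensions
      (lose {P = λ Q → border P (vertsOf P q) ∈ extensions Q} P∈Ps (∈-map⁺ _ (∈-allFin q)))

  leading-∈-extensions : ∀ {n} {P : Matrix n} {M} → M ∈ extensions P → leading M ≡ P
  leading-∈-extensions {n} {P} M∈P with ∈-map⁻ (λ q → border P (vertsOf P q)) {xs = allFin (suc n)} M∈P
  ... | q , _ , refl = leading-border P (vertsOf P q)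

  ∈enumeration⇒Stacked : ∀ n {P : Matrix n} → P ∈ enumeration n → Stacked n (vertsOf P) × UpperTriangular P
  ∈enumeration⇒Stacked zero (here refl) = point _ , λ ()
  ∈enumeration⇒Stacked (suc n) P∈ with ∈-concatMap-extensions⁻ (enumeration n) P∈
  ... | P′ , P′∈ , q , refl =
    let T , ut = ∈enumeration⇒Stacked n P′∈
    in stack T q (border-Extension P′ (vertsOf P′ q)) , UpperTriangular-border P′ (vertsOf P′ q) ut

  border-injective : ∀ {n} {P : Matrix n} → Stacked n (vertsOf P) → ∀ {q q′} →
                     border P (vertsOf P q) ≡ border P (vertsOf P q′) → q ≡ q′
  border-injective {n} {P} T {q} {q′} eq = Stacked-vertex-injective T q q′ (λ r →
    trans (sym (entry-border-init-last P (vertsOf P q) r))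
          (trans (cong (λ M → entry M (inject₁ r) (fromℕ n)) eq) (entry-border-init-last P (vertsOf P q′) r)))

  Unique-concatMap-extensions : ∀ {n} (Ps : List (Matrix n)) → Unique Ps →
                                (∀ {P} → P ∈ Ps → Stacked n (vertsOf P)) →
                                Unique (concatMap extensions Ps)
  Unique-concatMap-extensions []       _                    _       = AllPairs.[]
  Unique-concatMap-extensions {n} (P ∷ Ps) (P∉Ps AllPairs.∷ unique) stacked =
    ++⁺ (map⁺ (border-injective (stacked (here refl))) (allFin⁺ (suc n)))
        (Unique-concatMap-extensions Ps unique (stacked ∘ there))
        disjoint
    where
    disjoint : ∀ {M} → ¬ (M ∈ extensions P × M ∈ concatMap extensions Ps)
    disjoint (M∈P , M∈Ps) =
      let P′ , P′∈Ps , M∈P′ = find (∈-concatMap⁻ extensions {xs = Ps} M∈Ps)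
      in All.lookup P∉Ps P′∈Ps (trans (sym (leading-∈-extensions M∈P)) (leading-∈-extensions M∈P′))

  Unique-enumeration : ∀ n → Unique (enumeration n)
  Unique-enumeration zero    = All.[] AllPairs.∷ AllPairs.[]
  Unique-enumeration (suc n) = Unique-concatMap-extensions (enumeration n) (Unique-enumeration n)
    (proj₁ ∘ ∈enumeration⇒Stacked n)

  UpperTriangular⇒∈enumeration : ∀ n (P : Matrix n) → UpperTriangular P → AffIndep (vertsOf P) →
                                 (2 ℕ.≤ n → Nonobtuse (vertsOf P)) → P ∈ enumeration n
  UpperTriangular⇒∈enumeration zero    []  _  _     _         = here refl
  UpperTriangular⇒∈enumeration (suc n) P ut indep nonobtuse =
    subst (_∈ enumeration (suc n)) (sym P≡border) (∈-concatMap-extensions⁺ leading∈ q)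
    where
    last-diag = AffIndep⇒unit-diagonal (suc n) P ut indep (fromℕ n)
    E : Extension (vertsOf P) (vertsOf (leading P)) (lastColumn P) true
    E = subst (Extension (vertsOf P) (vertsOf (leading P)) (lastColumn P)) last-diag (vertsOf-Extension P ut)
    leading∈ : leading P ∈ enumeration n
    leading∈ = UpperTriangular⇒∈enumeration n (leading P) (UpperTriangular-leading P ut) (AffIndep-base E indep)
                 (λ 2≤n → Nonobtuse-base E (nonobtuse (ℕ.m≤n⇒m≤1+n 2≤n)))
    apex-vertex = Nonobtuse⇒apex-vertex (proj₁ (∈enumeration⇒Stacked n leading∈)) E nonobtuse
    q = proj₁ apex-vertex
    P≡border : P ≡ border (leading P) (vertsOf (leading P) q)
    P≡border = ≡border P ut last-diag (proj₂ apex-vertex)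

open import Defs
open import Data.Nat using (ℕ; suc; _≤_; _!)
open import Data.List using (List; length)
open import Data.List.Membership.Propositional using (_∈_)
open import Data.List.Relation.Unary.Unique.Propositional using (Unique)
open import Data.Product using (_×_; ∃; _,_)
open import Function.Bundles using (_⇔_; mk⇔)
open import Relation.Binary.PropositionalEquality using (_≡_)
open OrthogonalSimplices

proposition5p1 : (n : ℕ) → 1 ≤ n →
    ∃ λ (L : List (Matrix n)) →
    Unique L × length L ≡ n ! ×
    ((P : Matrix n) → P ∈ L ⇔ (UpperTriangular P × Orthogonal n (vertsOf P)))
proposition5p1 (suc m) _ =
  enumeration (suc m) , Unique-enumeration (suc m) , length-enumeration (suc m) , λ P → mk⇔
    (λ P∈ → let T , ut = ∈enumeration⇒Stacked (suc m) P∈ in ut , Stacked⇒Orthogonal T)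
    (λ (ut , orth) →
      UpperTriangular⇒∈enumeration (suc m) P ut (Orthogonal⇒AffIndep orth) (Orthogonal⇒Nonobtuse orth))
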